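{- Let $G$ be a finite group and $H$ a subgroup of $G$. If the core of $H$ in $G$ is not contained in the center of $G$, then there is no connected Cayley sum graph of $G$ admitting $H$ as a total perfect code.
   Context: All groups are finite. A subset $Y$ of $G$ is normal if $g^{ -1}Yg=Y$ for all $g\in G$. For a normal subset $Y$ of $G$, the Cayley sum graph $\mathrm{CS}(G,Y)$ is the simple graph with vertex set $G$ in which distinct vertices $g,h$ are adjacent iff $gh\in Y$. A total perfect code in a graph is a set $C$ of vertices such that every vertex has exactly one neighbour in $C$. The core of $H$ in $G$ is the largest normal subgroup of $G$ contained in $H$. -}

module Defs where

open import Level using (0ℓ)
open import Data.Nat using (ℕ)
open import Data.Fin using (Fin)
open import Data.Fin.Subset using (Subset; _∈_; _∉_; _⊆_)
open import Data.Product using (Σ; ∃; ∃-syntax; ∃!; _×_; _,_)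
open import Relation.Nullary using (¬_)
open import Relation.Binary.PropositionalEquality using (_≡_; _≢_)
open import Relation.Binary.Construct.Closure.ReflexiveTransitive using (Star)
open import Function.Bundles using (_⇔_)
open import Algebra.Structures using (IsGroup)

-- A finite group, presented (up to isomorphism) on the carrier Fin n,
-- with propositional equality as the group equality.
record FinGroup : Set where
  field
    n       : ℕ
    _·_     : Fin n → Fin n → Fin n
    e       : Fin n
    _⁻¹     : Fin n → Fin n
    isGroup : IsGroup _≡_ _·_ e _⁻¹
  infixl 7 _·_
  infix 8 _⁻¹

module _ (G : FinGroup) where
  open FinGroup G

  IsSubgroup : Subset n → Set
  IsSubgroup H = (e ∈ H)
               × (∀ x y → x ∈ H → y ∈ H → x · y ∈ H)
               × (∀ x → x ∈ H → x ⁻¹ ∈ H)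

  IsNormalSubset : Subset n → Set
  IsNormalSubset Y = ∀ g x → (x ∈ Y ⇔ (∃[ y ] (y ∈ Y × x ≡ g ⁻¹ · y · g)))

  IsNormalSubgroup : Subset n → Set
  IsNormalSubgroup N = IsSubgroup N × IsNormalSubset N

  IsCore : Subset n → Subset n → Set
  IsCore K H = IsNormalSubgroup K × K ⊆ H
             × (∀ N → IsNormalSubgroup N → N ⊆ H → N ⊆ K)

  InCenter : Fin n → Set
  InCenter x = ∀ g → x · g ≡ g · x

  CSAdj : Subset n → Fin n → Fin n → Set
  CSAdj Y g h = g ≢ h × g · h ∈ Y

  CSConnected : Subset n → Set
  CSConnected Y = ∀ g h → Star (CSAdj Y) g h

  IsTotalPerfectCode : Subset n → Subset n → Set
  IsTotalPerfectCode Y C = ∀ v → ∃! _≡_ (λ c → c ∈ C × CSAdj Y v c)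

-- Let K be a normal subgroup of G contained in a total perfect code H of the
-- connected Cayley sum graph CS(G,Y), and let k ∈ K. For y ∈ Y the element
-- k⁻¹yk again lies in Y, and the edges y–1 and y–(y⁻¹k⁻¹yk) (when y ∉ H), or
-- 1–y and 1–k⁻¹yk (when y ∈ H), are two edges from one vertex into H; perfectness
-- forces y = k⁻¹yk. So k centralises Y. If k commutes with x and with x·j, it
-- commutes with j; walking along edges from 1 shows that k is central, so the
-- core of H, itself such a K, lies in the centre.
module Submission where

open import Defs
open import Level using (0ℓ)
open import Data.Fin using (Fin; _≟_)
open import Data.Fin.Subset using (Subset; _∈_; _⊆_)
open import Data.Fin.Subset.Properties using (_∈?_)
open import Data.Product using (∃-syntax; _×_; _,_)
open import Relation.Nullary using (¬_; yes; no)
open import Relation.Binary.PropositionalEquality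
open import Relation.Binary.Construct.Closure.ReflexiveTransitive using (Star; ε; _◅_)
open import Function.Bundles using (Equivalence)
open import Algebra.Bundles using (Group)
open import Algebra.Structures using (IsGroup)
import Algebra.Properties.Group as GroupProperties

module _ (G : FinGroup) where
  open FinGroup G
  open IsGroup isGroup using (assoc; identityˡ; identityʳ; inverseˡ)
  open ≡-Reasoning

  group : Group 0ℓ 0ℓ
  group = record { isGroup = isGroup }

  open GroupProperties group using (∙-cancelˡ; ∙-cancelʳ; \\-leftDividesˡ)

  Commute : Fin n → Fin n → Set
  Commute x y = x · y ≡ y · x

  infixl 8 _^_
  _^_ : Fin n → Fin n → Fin n
  y ^ k = k ⁻¹ · y · k

  commute-e : ∀ k → Commute k e
  commute-e k = trans (identityʳ k) (sym (identityˡ k))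

  ^-fixed⇒commute : ∀ y k → y ≡ y ^ k → Commute k y
  ^-fixed⇒commute y k y≡y^k = begin
    k · y                ≡⟨ cong (k ·_) y≡y^k ⟩
    k · (k ⁻¹ · y · k)   ≡⟨ sym (assoc k (k ⁻¹ · y) k) ⟩
    k · (k ⁻¹ · y) · k   ≡⟨ cong (_· k) (\\-leftDividesˡ k y) ⟩
    y · k                ∎

  ^≡e⇒≡e : ∀ y k → y ^ k ≡ e → y ≡ e
  ^≡e⇒≡e y k y^k≡e = ∙-cancelˡ (k ⁻¹) y e (∙-cancelʳ k (k ⁻¹ · y) (k ⁻¹ · e) (begin
    k ⁻¹ · y · k   ≡⟨ y^k≡e ⟩
    e              ≡⟨ sym (inverseˡ k) ⟩
    k ⁻¹ · k       ≡⟨ cong (_· k) (sym (identityʳ (k ⁻¹))) ⟩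
    k ⁻¹ · e · k   ∎))

  y·[k⁻¹^y·k]≡y^k : ∀ y k → y · (k ⁻¹ ^ y · k) ≡ y ^ k
  y·[k⁻¹^y·k]≡y^k y k = begin
    y · (y ⁻¹ · k ⁻¹ · y · k)     ≡⟨ sym (assoc y (y ⁻¹ · k ⁻¹ · y) k) ⟩
    y · (y ⁻¹ · k ⁻¹ · y) · k     ≡⟨ cong (_· k) (sym (assoc y (y ⁻¹ · k ⁻¹) y)) ⟩
    y · (y ⁻¹ · k ⁻¹) · y · k     ≡⟨ cong (λ z → z · y · k) (\\-leftDividesˡ y (k ⁻¹)) ⟩
    k ⁻¹ · y · k                  ∎

  commute-cancelˡ : ∀ k x j → Commute k x → Commute k (x · j) → Commute k j
  commute-cancelˡ k x j kx≡xk kxj≡xjk = ∙-cancelˡ x (k · j) (j · k) (begin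
    x · (k · j)   ≡⟨ sym (assoc x k j) ⟩
    x · k · j     ≡⟨ cong (_· j) (sym kx≡xk) ⟩
    k · x · j     ≡⟨ assoc k x j ⟩
    k · (x · j)   ≡⟨ kxj≡xjk ⟩
    x · j · k     ≡⟨ assoc x j k ⟩
    x · (j · k)   ∎)

  ^-closed : ∀ {S} → IsNormalSubset G S → ∀ {x} k → x ∈ S → x ^ k ∈ S
  ^-closed normS {x} k x∈S = Equivalence.from (normS k (x ^ k)) (x , x∈S , refl)

  code-neighbour-unique : ∀ {Y C} → IsTotalPerfectCode G Y C → ∀ {v c c′}
    → c ∈ C → CSAdj G Y v c → c′ ∈ C → CSAdj G Y v c′ → c ≡ c′
  code-neighbour-unique code {v} c∈C v~c c′∈C v~c′ with code v
  ... | c₀ , _ , c₀-unique = trans (sym (c₀-unique (c∈C , v~c))) (c₀-unique (c′∈C , v~c′))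

  commute-along-path : ∀ {Y} k → (∀ y → y ∈ Y → Commute k y)
    → ∀ {x g} → Star (CSAdj G Y) x g → Commute k x → Commute k g
  commute-along-path k k-centralises-Y ε kx≡xk = kx≡xk
  commute-along-path k k-centralises-Y {x} (_◅_ {j = j} (_ , xj∈Y) path) kx≡xk =
    commute-along-path k k-centralises-Y path
      (commute-cancelˡ k x j kx≡xk (k-centralises-Y (x · j) xj∈Y))

  module _ {Y H K : Subset n}
           (normY : IsNormalSubset G Y) (subH : IsSubgroup G H)
           (normalK : IsNormalSubgroup G K) (K⊆H : K ⊆ H)
           (code : IsTotalPerfectCode G Y H) where

    private
      e∈H = let (e∈H , _ , _) = subH in e∈H
      ·-closedH = let (_ , ·-closedH , _) = subH in ·-closedH
      ·-closedK = let ((_ , ·-closedK , _) , _) = normalK in ·-closedK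
      ⁻¹-closedK = let ((_ , _ , ⁻¹-closedK) , _) = normalK in ⁻¹-closedK
      normK = let (_ , normK) = normalK in normK

      ∉H⇒≢ : ∀ {x c} → ¬ x ∈ H → c ∈ H → x ≢ c
      ∉H⇒≢ x∉H c∈H refl = x∉H c∈H

    normal-subgroup-centralises-connection-set : ∀ k → k ∈ K → ∀ y → y ∈ Y → Commute k y
    normal-subgroup-centralises-connection-set k k∈K y y∈Y with y ∈? H
    ... | no y∉H = ^-fixed⇒commute y k (begin
      y                  ≡⟨ sym (identityʳ y) ⟩
      y · e              ≡⟨ cong (y ·_) (code-neighbour-unique code e∈H y~e c∈H y~c) ⟩
      y · (k ⁻¹ ^ y · k) ≡⟨ y·[k⁻¹^y·k]≡y^k y k ⟩
      y ^ k              ∎)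
      where
      c∈H : k ⁻¹ ^ y · k ∈ H
      c∈H = K⊆H (·-closedK _ _ (^-closed normK y (⁻¹-closedK k k∈K)) k∈K)
      y~e : CSAdj G Y y e
      y~e = ∉H⇒≢ y∉H e∈H , subst (_∈ Y) (sym (identityʳ y)) y∈Y
      y~c : CSAdj G Y y (k ⁻¹ ^ y · k)
      y~c = ∉H⇒≢ y∉H c∈H , subst (_∈ Y) (sym (y·[k⁻¹^y·k]≡y^k y k)) (^-closed normY k y∈Y)
    ... | yes y∈H with y ≟ e
    ...   | yes refl = commute-e k
    ...   | no y≢e = ^-fixed⇒commute y k
                       (code-neighbour-unique code y∈H e~y y^k∈H e~y^k)
      where
      y^k∈H : y ^ k ∈ H
      y^k∈H = ·-closedH _ _ (·-closedH _ _ (K⊆H (⁻¹-closedK k k∈K)) y∈H) (K⊆H k∈K)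
      e~y : CSAdj G Y e y
      e~y = (λ e≡y → y≢e (sym e≡y)) , subst (_∈ Y) (sym (identityˡ y)) y∈Y
      e~y^k : CSAdj G Y e (y ^ k)
      e~y^k = (λ e≡y^k → y≢e (^≡e⇒≡e y k (sym e≡y^k)))
            , subst (_∈ Y) (sym (identityˡ (y ^ k))) (^-closed normY k y∈Y)

theorem4p5 : (G : FinGroup) (H K : Subset (FinGroup.n G))
    → IsSubgroup G H
    → IsCore G K H
    → ¬ (∀ x → x ∈ K → InCenter G x)
    → ¬ (∃[ Y ] (IsNormalSubset G Y × CSConnected G Y × IsTotalPerfectCode G Y H))
theorem4p5 G H K subH (normalK , K⊆H , _) K⊈Z (Y , normY , connected , code) =
  K⊈Z λ k k∈K g →
    commute-along-path G k
      (normal-subgroup-centralises-connection-set G normY subH normalK K⊆H code k k∈K)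
      (connected (FinGroup.e G) g) (commute-e G k)
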